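{- Let $G^1$ be a 1-graph in which every two nodes are the terminal nodes of some two-ended walk. Then the ordinal-valued wdistance $d$ restricted to the maximal nodes of $G^1$ satisfies the metric axioms: $d(x,x)=0$, $d(x,y)>0$ for $x\ne y$, $d(x,y)=d(y,x)$, and $d(x,z)\le d(x,y)+d(y,z)$ for all maximal nodes $x,y,z$, where $+$ is the natural (Hessenberg) sum of ordinals.
   Context: Let $G^0=\{X^0,B\}$ be a graph with 0-nodes $X^0$ and branches $B$ (two-element subsets of $X^0$). A 0-tip is an equivalence class of one-ended paths of $G^0$ under eventual identity. Partition the 0-tips into subsets and add to each at most one 0-node (no 0-node added twice); each resulting set is a 1-node; $X^1$ is the set of 1-nodes and $G^1=\{X^0,B,X^1\}$. Nodes means 0-nodes or 1-nodes. A 0-node is maximal if it is contained in no 1-node; every 1-node is maximal. A 0-walk is a finite, one-way or two-way infinite alternating sequence of 0-nodes and branches, each branch incident to its two neighbouring 0-nodes, terminating at a 0-node on any side where it terminates; a one-ended (endless) 0-walk is extended if its tail (each tail) is eventually a one-ended path, and then it traverses that path's 0-tip. A 0-walk reaches a 1-node $x^1$ if it traverses a 0-tip in $x^1$ or terminates at a 0-node in $x^1$ (through a branch); it reaches any 0-node at which it terminates. A two-ended 1-walk is a finite sequence $\langle x_0,W_0^0,x_1^1,W_1^0,\dots,x_{m-1}^1,W_{m-1}^0,x_m\rangle$, $m\ge1$, where $x_1^1,\dots,x_{m-1}^1$ are 1-nodes, $x_0,x_m$ are nodes, each $W_k^0$ is a nontrivial 0-walk reaching the two nodes adjacent to it in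 the sequence, and for each $k=1,\dots,m-1$ at least one of $W_{k-1}^0,W_k^0$ reaches $x_k^1$ through a 0-tip. A two-ended walk is a finite 0-walk or a two-ended 1-walk. Lengths: a finite 0-walk has length equal to its number of branch traversals; an extended one-ended 0-walk has length $\omega$; an extended endless 0-walk has length $\omega\cdot2$; a two-ended 1-walk has length the natural sum of the lengths of its 0-walks (so of the form $\omega\cdot\tau_1+\tau_0$). The wdistance is $d(x,y)=\min|W_{x,y}|$ over all two-ended walks terminating at $x$ and $y$, with $d(x,x)=0$. -}

module Defs where

open import Data.Nat using (ℕ; zero; suc; _+_; _≤_; _<_)
open import Data.Fin using (Fin; inject₁; fromℕ) renaming (zero to fzero; suc to fsuc)
open import Data.Integer using (ℤ; +_; -_) renaming (_+_ to _+ℤ_)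
open import Data.Maybe using (Maybe; just)
open import Data.Product using (Σ; ∃; _×_; _,_)
open import Data.Sum using (_⊎_; inj₁; inj₂)
open import Data.Unit using (⊤)
open import Data.Empty using (⊥)
open import Relation.Binary.PropositionalEquality using (_≡_; _≢_)
open import Relation.Nullary using (¬_)
open import Function.Definitions using (Injective)

-- Ordinals below ω² : the pair (a , b) represents ω·a + b.

Ord : Set
Ord = ℕ × ℕ

ozero : Ord
ozero = (0 , 0)

_<ₒ_ : Ord → Ord → Set
(a , b) <ₒ (c , d) = (a < c) ⊎ ((a ≡ c) × (b < d))

_≤ₒ_ : Ord → Ord → Set
(a , b) ≤ₒ (c , d) = (a < c) ⊎ ((a ≡ c) × (b ≤ d))

-- natural (Hessenberg) sum: ω·a+b ⊕ ω·c+d = ω·(a+c) + (b+d)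
_⊕_ : Ord → Ord → Ord
(a , b) ⊕ (c , d) = (a + c , b + d)

IsPath : {X : Set} → (X → X → Set) → (ℕ → X) → Set
IsPath Adj p = (∀ n → Adj (p n) (p (suc n))) × Injective _≡_ _≡_ p

EvEq : {X : Set} → (ℕ → X) → (ℕ → X) → Set
EvEq p q = Σ ℕ λ i → Σ ℕ λ j → ∀ k → p (i + k) ≡ q (j + k)

shift : {X : Set} → ℕ → (ℕ → X) → (ℕ → X)
shift k p n = p (k + n)

-- Branches are two-element subsets of X⁰, encoded as a symmetric
-- irreflexive relation Adj.  1-nodes are indexed by X¹; tipIn i p says
-- that the 0-tip of the path p belongs to the 1-node i; the 1-nodes
-- partition the 0-tips (nonempty, disjoint, covering blocks, closed under
-- eventual identity); attach i is the (at most one) 0-node added to i,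
-- and no 0-node is added twice.

record OneGraph : Set₁ where
  field
    X⁰       : Set
    Adj      : X⁰ → X⁰ → Set
    Adj-sym  : ∀ {x y} → Adj x y → Adj y x
    Adj-irr  : ∀ {x} → ¬ Adj x x
    X¹       : Set
    tipIn    : X¹ → (ℕ → X⁰) → Set
    tipIn-resp : ∀ {i p q} → IsPath Adj p → IsPath Adj q → EvEq p q →
                 tipIn i p → tipIn i q
    tip-cover  : ∀ {p} → IsPath Adj p → ∃ λ i → tipIn i p
    tip-disj   : ∀ {i j p} → IsPath Adj p → tipIn i p → tipIn j p → i ≡ j
    block-nonempty : ∀ i → ∃ λ p → IsPath Adj p × tipIn i p
    attach     : X¹ → Maybe X⁰
    attach-inj : ∀ {i j x} → attach i ≡ just x → attach j ≡ just x → i ≡ j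

module OneGraphTheory (G : OneGraph) where
  open OneGraph G

  Node : Set
  Node = X⁰ ⊎ X¹

  Maximal : Node → Set
  Maximal (inj₁ x) = ¬ (∃ λ i → attach i ≡ just x)
  Maximal (inj₂ i) = ⊤

  -- 0-walks, oriented from a left end to a right end.
  --  fin   : finite walk f 0, f 1, …, f n   (n branch traversals)
  --  ray   : f 0, f 1, f 2, …               (terminates on the left)
  --  coray : …, f 2, f 1, f 0               (terminates on the right)
  --  line  : …, g (-1), g 0, g 1, …         (endless)
  data Walk0 : Set where
    fin   : (n : ℕ) (f : Fin (suc n) → X⁰) →
            (∀ (k : Fin n) → Adj (f (inject₁ k)) (f (fsuc k))) → Walk0
    ray   : (f : ℕ → X⁰) → (∀ n → Adj (f n) (f (suc n))) → Walk0
    coray : (f : ℕ → X⁰) → (∀ n → Adj (f n) (f (suc n))) → Walk0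
    line  : (g : ℤ → X⁰) → (∀ i → Adj (g i) (g (i +ℤ + 1))) → Walk0

  Nontrivial : Walk0 → Set
  Nontrivial (fin n _ _) = 1 ≤ n
  Nontrivial (ray _ _)   = ⊤
  Nontrivial (coray _ _) = ⊤
  Nontrivial (line _ _)  = ⊤

  len0 : Walk0 → Ord
  len0 (fin n _ _) = (0 , n)
  len0 (ray _ _)   = (1 , 0)
  len0 (coray _ _) = (1 , 0)
  len0 (line _ _)  = (2 , 0)

  TermReach : X⁰ → Node → Set
  TermReach x (inj₁ y) = x ≡ y
  TermReach x (inj₂ i) = attach i ≡ just x

  -- an infinite tail p (read outward) traverses a 0-tip lying in 1-node i
  TipIn : (ℕ → X⁰) → X¹ → Set
  TipIn p i = Σ ℕ λ k → IsPath Adj (shift k p) × tipIn i (shift k p)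

  TipReach : (ℕ → X⁰) → Node → Set
  TipReach p (inj₁ _) = ⊥
  TipReach p (inj₂ i) = TipIn p i

  leftTail : (ℤ → X⁰) → ℕ → X⁰
  leftTail g n = g (- (+ n))

  rightTail : (ℤ → X⁰) → ℕ → X⁰
  rightTail g n = g (+ n)

  LReach : Walk0 → Node → Set
  LReach (fin n f _) v = TermReach (f fzero) v
  LReach (ray f _)   v = TermReach (f 0) v
  LReach (coray f _) v = TipReach f v
  LReach (line g _)  v = TipReach (leftTail g) v

  RReach : Walk0 → Node → Set
  RReach (fin n f _) v = TermReach (f (fromℕ n)) v
  RReach (ray f _)   v = TipReach f v
  RReach (coray f _) v = TermReach (f 0) v
  RReach (line g _)  v = TipReach (rightTail g) v

  LTip : Walk0 → X¹ → Set
  LTip (fin _ _ _) i = ⊥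
  LTip (ray _ _)   i = ⊥
  LTip (coray f _) i = TipIn f i
  LTip (line g _)  i = TipIn (leftTail g) i

  RTip : Walk0 → X¹ → Set
  RTip (fin _ _ _) i = ⊥
  RTip (ray f _)   i = TipIn f i
  RTip (coray _ _) i = ⊥
  RTip (line g _)  i = TipIn (rightTail g) i

  -- two-ended 1-walks ⟨x, W₀, x₁¹, …, W_{m-1}, y⟩, built from the left;
  -- the index W is the last 0-walk of the sequence.
  data Walk1 (x : Node) : Walk0 → Node → Set where
    one  : ∀ {y} (W : Walk0) → Nontrivial W → LReach W x → RReach W y →
           Walk1 x W y
    snoc : ∀ {V i y} → Walk1 x V (inj₂ i) →
           (W : Walk0) → Nontrivial W → LReach W (inj₂ i) → RReach W y →
           (RTip V i ⊎ LTip W i) → Walk1 x W y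

  len1 : ∀ {x W y} → Walk1 x W y → Ord
  len1 (one W _ _ _)          = len0 W
  len1 (snoc c W _ _ _ _)     = len1 c ⊕ len0 W

  data TwoEnded (x y : Node) : Set where
    walk0 : (n : ℕ) (f : Fin (suc n) → X⁰)
            (adj : ∀ (k : Fin n) → Adj (f (inject₁ k)) (f (fsuc k))) →
            x ≡ inj₁ (f fzero) → y ≡ inj₁ (f (fromℕ n)) → TwoEnded x y
    walk1 : (W : Walk0) → Walk1 x W y → TwoEnded x y

  len : ∀ {x y} → TwoEnded x y → Ord
  len (walk0 n _ _ _ _) = (0 , n)
  len (walk1 _ w)       = len1 w

  IsWDist : Node → Node → Ord → Set
  IsWDist x y o =
    ((x ≡ y) × (o ≡ ozero)) ⊎
    ((x ≢ y) × (Σ (TwoEnded x y) λ w → len w ≡ o)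
             × (∀ (w : TwoEnded x y) → o ≤ₒ len w))

-- The wdistance is by definition the least length of a two-ended walk, so
-- the metric axioms reduce to two constructions on walks.  Reversing a walk
-- preserves its length, which gives symmetry.  Two walks meeting at a node
-- concatenate into a walk whose length is at most the natural sum of their
-- lengths, which gives the triangle inequality: at a 1-node reached through
-- a 0-tip by one of them the sequences are simply juxtaposed; otherwise
-- both end at the 0-node attached to the meeting node, and the two 0-walks
-- there are merged into one, which can only shorten the walk (a finite
-- walk followed by a ray is a ray, of length ω ≤ n ⊕ ω).  Positivity holds
-- because every constituent 0-walk is nontrivial.

module Submission where

open import Defs
open import Data.Product using (_×_)
open import Relation.Binary.PropositionalEquality using (_≡_; _≢_)

open import Data.Empty using (⊥; ⊥-elim)
open import Data.Fin using (Fin; inject₁; fromℕ; toℕ) renaming (zero to fzero; suc to fsuc)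
open import Data.Fin.Properties using (toℕ-fromℕ; toℕ-inject₁; toℕ<n)
open import Data.Integer using (ℤ; +_; -[1+_]; -_) renaming (_+_ to _+ℤ_)
import Data.Integer.Properties as ℤ
open import Data.Maybe.Properties using (just-injective)
open import Data.Nat using (ℕ; zero; suc; _+_; _∸_; _≤_; _<_; z≤n; s≤s)
import Data.Nat.Properties as ℕ
open import Algebra.Properties.CommutativeSemigroup ℕ.+-commutativeSemigroup using (x∙yz≈y∙xz)
open import Data.Product using (Σ; ∃; _,_; proj₁; proj₂)
open import Data.Product.Relation.Binary.Lex.Strict using (×-transitive; ×-antisymmetric)
open import Data.Product.Relation.Binary.Pointwise.NonDependent using (≡×≡⇒≡)
open import Data.Sum using (_⊎_; inj₁; inj₂; map₁; map₂)
open import Data.Unit using (tt)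
open import Function using (_∘_)
open import Relation.Binary.Definitions using (Transitive; Antisymmetric)
open import Relation.Binary.PropositionalEquality
  using (refl; sym; trans; cong; cong₂; subst; subst₂; isEquivalence; resp₂; module ≡-Reasoning)

≤ₒ-refl : ∀ o → o ≤ₒ o
≤ₒ-refl o = inj₂ (refl , ℕ.≤-refl)

≤ₒ-reflexive : ∀ {o o′} → o ≡ o′ → o ≤ₒ o′
≤ₒ-reflexive refl = ≤ₒ-refl _

≤ₒ-trans : Transitive _≤ₒ_
≤ₒ-trans = ×-transitive {_≈₁_ = _≡_} {_<₁_ = _<_} {_<₂_ = _≤_}
             isEquivalence (resp₂ _<_) ℕ.<-trans ℕ.≤-trans

≤ₒ-antisym : Antisymmetric _≡_ _≤ₒ_
≤ₒ-antisym p q = ≡×≡⇒≡ (×-antisymmetric {_≈₁_ = _≡_} {_<₁_ = _<_} {_<₂_ = _≤_}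
                           sym ℕ.<-irrefl ℕ.<-asym ℕ.≤-antisym p q)

ozero-≤ₒ : ∀ o → ozero ≤ₒ o
ozero-≤ₒ (zero  , b) = inj₂ (refl , z≤n)
ozero-≤ₒ (suc a , b) = inj₁ (s≤s z≤n)

⊕-comm : ∀ o o′ → o ⊕ o′ ≡ o′ ⊕ o
⊕-comm (a , b) (c , d) = cong₂ _,_ (ℕ.+-comm a c) (ℕ.+-comm b d)

⊕-assoc : ∀ o o′ o″ → (o ⊕ o′) ⊕ o″ ≡ o ⊕ (o′ ⊕ o″)
⊕-assoc (a , b) (c , d) (e , f) = cong₂ _,_ (ℕ.+-assoc a c e) (ℕ.+-assoc b d f)

⊕-identityʳ : ∀ o → o ⊕ ozero ≡ o
⊕-identityʳ (a , b) = cong₂ _,_ (ℕ.+-identityʳ a) (ℕ.+-identityʳ b)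

⊕-monoʳ-≤ₒ : ∀ o {p q} → p ≤ₒ q → (o ⊕ p) ≤ₒ (o ⊕ q)
⊕-monoʳ-≤ₒ (a , b) (inj₁ c<e)         = inj₁ (ℕ.+-monoʳ-< a c<e)
⊕-monoʳ-≤ₒ (a , b) (inj₂ (refl , d≤f)) = inj₂ (refl , ℕ.+-monoʳ-≤ b d≤f)

⊕-monoˡ-≤ₒ : ∀ o {p q} → p ≤ₒ q → (p ⊕ o) ≤ₒ (q ⊕ o)
⊕-monoˡ-≤ₒ o {p} {q} p≤q = subst₂ _≤ₒ_ (⊕-comm o p) (⊕-comm o q) (⊕-monoʳ-≤ₒ o p≤q)

⊕-positiveʳ : ∀ o {p} → ozero <ₒ p → ozero <ₒ (o ⊕ p)
⊕-positiveʳ (a     , b) (inj₁ 0<c)         = inj₁ (ℕ.≤-trans 0<c (ℕ.m≤n+m _ a))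
⊕-positiveʳ (zero  , b) (inj₂ (refl , 0<d)) = inj₂ (refl , ℕ.≤-trans 0<d (ℕ.m≤n+m _ b))
⊕-positiveʳ (suc a , b) (inj₂ (refl , _))   = inj₁ (s≤s z≤n)

module Walks (G : OneGraph) where
  open OneGraph G
  open OneGraphTheory G

  IsPath-cong : ∀ {p q : ℕ → X⁰} → (∀ n → p n ≡ q n) → IsPath Adj p → IsPath Adj q
  IsPath-cong p≗q (adjacent , injective) =
    (λ n → subst₂ Adj (p≗q n) (p≗q (suc n)) (adjacent n)) ,
    (λ {m} {n} eq → injective (trans (p≗q m) (trans eq (sym (p≗q n)))))

  IsPath-shift : ∀ {p : ℕ → X⁰} j → IsPath Adj p → IsPath Adj (shift j p)
  IsPath-shift {p} j (adjacent , injective) =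
    (λ n → subst (Adj (p (j + n)) ∘ p) (sym (ℕ.+-suc j n)) (adjacent (j + n))) ,
    (λ {m} {n} eq → ℕ.+-cancelˡ-≡ j m n (injective eq))

  tipIn-shift : ∀ {i} {p : ℕ → X⁰} j → IsPath Adj p → tipIn i p → tipIn i (shift j p)
  tipIn-shift j P = tipIn-resp P (IsPath-shift j P) (j , 0 , λ _ → refl)

  TipIn-resp-EvEq : ∀ {p q : ℕ → X⁰} {i} → EvEq p q → TipIn p i → TipIn q i
  TipIn-resp-EvEq {p} {q} (m , m′ , p≈q) (j , P , T) =
    m′ + j , Q , tipIn-resp P′ Q (0 , 0 , agree) (tipIn-shift m P T)
    where
      open ≡-Reasoning
      P′ : IsPath Adj (shift m (shift j p))
      P′ = IsPath-shift m P
      agree : ∀ n → shift m (shift j p) n ≡ shift (m′ + j) q n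
      agree n = begin
        p (j + (m + n))  ≡⟨ cong p (x∙yz≈y∙xz j m n) ⟩
        p (m + (j + n))  ≡⟨ p≈q (j + n) ⟩
        q (m′ + (j + n)) ≡⟨ cong q (ℕ.+-assoc m′ j n) ⟨
        q (m′ + j + n)   ∎
      Q : IsPath Adj (shift (m′ + j) q)
      Q = IsPath-cong agree P′

  TipReach-resp-EvEq : ∀ {p q : ℕ → X⁰} → EvEq p q → ∀ v → TipReach p v → TipReach q v
  TipReach-resp-EvEq         _   (inj₁ _) ()
  TipReach-resp-EvEq {p} {q} p≈q (inj₂ i) = TipIn-resp-EvEq {p} {q} p≈q

  TipEnd-resp-EvEq : ∀ {p q : ℕ → X⁰} → EvEq p q →
                     (∀ v → TipReach p v → TipReach q v) × (∀ i → TipIn p i → TipIn q i)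
  TipEnd-resp-EvEq {p} {q} p≈q = TipReach-resp-EvEq {p} {q} p≈q , λ _ → TipIn-resp-EvEq {p} {q} p≈q

  TermReach-subst : ∀ {a b} v → a ≡ b → TermReach a v → TermReach b v
  TermReach-subst v a≡b = subst (λ u → TermReach u v) a≡b

  TermReach-unique : ∀ {a b} v → TermReach a v → TermReach b v → a ≡ b
  TermReach-unique (inj₁ x) a≡x b≡x = trans a≡x (sym b≡x)
  TermReach-unique (inj₂ i) ia ib   = just-injective (trans (sym ia) ib)

  clamp : ∀ {n} → ℕ → Fin (suc n)
  clamp zero            = fzero
  clamp {zero}  (suc k) = fzero
  clamp {suc n} (suc k) = fsuc (clamp k)

  clamp-fromℕ : ∀ n → clamp n ≡ fromℕ n
  clamp-fromℕ zero    = refl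
  clamp-fromℕ (suc n) = cong fsuc (clamp-fromℕ n)

  AdjacentBelow : ℕ → (ℕ → X⁰) → Set
  AdjacentBelow n F = ∀ k → k < n → Adj (F k) (F (suc k))

  clamp-adjacent : ∀ {n} (f : Fin (suc n) → X⁰) → (∀ (k : Fin n) → Adj (f (inject₁ k)) (f (fsuc k))) →
                   AdjacentBelow n (f ∘ clamp)
  clamp-adjacent {suc n} f adj zero    _          = adj fzero
  clamp-adjacent {suc n} f adj (suc k) (s≤s k<n) = clamp-adjacent {n} (f ∘ fsuc) (adj ∘ fsuc) k k<n

  finWalk : (n : ℕ) (F : ℕ → X⁰) → AdjacentBelow n F → Walk0
  finWalk n F adj = fin n (F ∘ toℕ)
    (λ k → subst (λ t → Adj (F t) (F (suc (toℕ k)))) (sym (toℕ-inject₁ k)) (adj (toℕ k) (toℕ<n k)))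

  AdjacentBelow-reverse : ∀ n (F : ℕ → X⁰) → AdjacentBelow n F → AdjacentBelow n (λ k → F (n ∸ k))
  AdjacentBelow-reverse (suc n) F adj zero    _         = Adj-sym (adj n ℕ.≤-refl)
  AdjacentBelow-reverse (suc n) F adj (suc k) (s≤s k<n) =
    AdjacentBelow-reverse n F (λ j j<n → adj j (ℕ.m<n⇒m<1+n j<n)) k k<n

  splice : ℕ → (ℕ → X⁰) → (ℕ → X⁰) → ℕ → X⁰
  splice zero    F G k       = G k
  splice (suc n) F G zero    = F 0
  splice (suc n) F G (suc k) = splice n (F ∘ suc) G k

  splice-start : ∀ n F G → F n ≡ G 0 → splice n F G 0 ≡ F 0
  splice-start zero    F G Fn≡G0 = sym Fn≡G0
  splice-start (suc n) F G _     = refl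

  splice-shift : ∀ n F G k → splice n F G (n + k) ≡ G k
  splice-shift zero    F G k = refl
  splice-shift (suc n) F G k = splice-shift n (F ∘ suc) G k

  EvEq-splice : ∀ n F G → EvEq G (splice n F G)
  EvEq-splice n F G = 0 , n , λ k → sym (splice-shift n F G k)

  splice-adjacent : ∀ n m F G → F n ≡ G 0 → AdjacentBelow n F → AdjacentBelow m G →
                    AdjacentBelow (n + m) (splice n F G)
  splice-adjacent zero    m F G _     _    adjG k       k<m = adjG k k<m
  splice-adjacent (suc n) m F G Fn≡G0 adjF _    zero    _   =
    subst (Adj (F 0)) (sym (splice-start n (F ∘ suc) G Fn≡G0)) (adjF 0 (s≤s z≤n))
  splice-adjacent (suc n) m F G Fn≡G0 adjF adjG (suc k) (s≤s k<n+m) =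
    splice-adjacent n m (F ∘ suc) G Fn≡G0 (λ j j<n → adjF (suc j) (s≤s j<n)) adjG k k<n+m

  splice-adjacent-ray : ∀ n F G → F n ≡ G 0 → AdjacentBelow n F → (∀ k → Adj (G k) (G (suc k))) →
                        ∀ k → Adj (splice n F G k) (splice n F G (suc k))
  splice-adjacent-ray n F G Fn≡G0 adjF adjG k =
    splice-adjacent n (suc k) F G Fn≡G0 adjF (λ j _ → adjG j) k (ℕ.m≤n+m (suc k) n)

  reverse₀ : Walk0 → Walk0
  reverse₀ (fin n f adj) = finWalk n (λ k → f (clamp (n ∸ k)))
                             (AdjacentBelow-reverse n (f ∘ clamp) (clamp-adjacent f adj))
  reverse₀ (ray f adj)   = coray f adj
  reverse₀ (coray f adj) = ray f adj
  reverse₀ (line g adj)  =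
    line (g ∘ -_) (λ i → Adj-sym (subst (Adj (g (- (i +ℤ + 1))) ∘ g) (-[i+1]+1≡-i i) (adj _)))
    where
      -[i+1]+1≡-i : ∀ i → - (i +ℤ + 1) +ℤ + 1 ≡ - i
      -[i+1]+1≡-i i = trans (cong (_+ℤ + 1) (ℤ.neg-distrib-+ i (+ 1)))
                       (trans (ℤ.+-assoc (- i) (- (+ 1)) (+ 1)) (ℤ.+-identityʳ (- i)))

  EvEq-reverse-line : ∀ g → EvEq (rightTail g) (leftTail (g ∘ -_))
  EvEq-reverse-line g = 0 , 0 , λ k → cong g (sym (ℤ.neg-involutive (+ k)))

  reverse₀-RReach : ∀ W v → LReach W v → RReach (reverse₀ W) v
  reverse₀-RReach (fin n f _) v = TermReach-subst v (cong (f ∘ clamp) (sym n∸n≡0′))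
    where
      n∸n≡0′ : n ∸ toℕ (fromℕ n) ≡ 0
      n∸n≡0′ = trans (cong (n ∸_) (toℕ-fromℕ n)) (ℕ.n∸n≡0 n)
  reverse₀-RReach (ray _ _)   v t = t
  reverse₀-RReach (coray _ _) v t = t
  reverse₀-RReach (line _ _)  v t = t

  reverse₀-LReach : ∀ W v → RReach W v → LReach (reverse₀ W) v
  reverse₀-LReach (fin n f _) v = TermReach-subst v (cong f (sym (clamp-fromℕ n)))
  reverse₀-LReach (ray _ _)   v t = t
  reverse₀-LReach (coray _ _) v t = t
  reverse₀-LReach (line g _)  v = TipReach-resp-EvEq (EvEq-reverse-line g) v

  reverse₀-RTip : ∀ W i → LTip W i → RTip (reverse₀ W) i
  reverse₀-RTip (fin _ _ _) i ()
  reverse₀-RTip (ray _ _)   i ()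
  reverse₀-RTip (coray _ _) i t = t
  reverse₀-RTip (line _ _)  i t = t

  reverse₀-LTip : ∀ W i → RTip W i → LTip (reverse₀ W) i
  reverse₀-LTip (fin _ _ _) i ()
  reverse₀-LTip (ray _ _)   i t = t
  reverse₀-LTip (coray _ _) i ()
  reverse₀-LTip (line g _)  i = TipIn-resp-EvEq {rightTail g} {leftTail (g ∘ -_)} (EvEq-reverse-line g)

  reverse₀-nontrivial : ∀ W → Nontrivial W → Nontrivial (reverse₀ W)
  reverse₀-nontrivial (fin _ _ _) nt = nt
  reverse₀-nontrivial (ray _ _)   nt = nt
  reverse₀-nontrivial (coray _ _) nt = nt
  reverse₀-nontrivial (line _ _)  nt = nt

  len0-reverse₀ : ∀ W → len0 (reverse₀ W) ≡ len0 W
  len0-reverse₀ (fin _ _ _) = refl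
  len0-reverse₀ (ray _ _)   = refl
  len0-reverse₀ (coray _ _) = refl
  len0-reverse₀ (line _ _)  = refl

  first₀ : ∀ {x W y} → Walk1 x W y → Walk0
  first₀ (one W _ _ _)      = W
  first₀ (snoc c _ _ _ _ _) = first₀ c

  first₀-LReach : ∀ {x W y} (c : Walk1 x W y) → LReach (first₀ c) x
  first₀-LReach (one _ _ l _)      = l
  first₀-LReach (snoc c _ _ _ _ _) = first₀-LReach c

  last-RReach : ∀ {x W y} → Walk1 x W y → RReach W y
  last-RReach (one _ _ _ r)      = r
  last-RReach (snoc _ _ _ _ r _) = r

  last-nontrivial : ∀ {x W y} → Walk1 x W y → Nontrivial W
  last-nontrivial (one _ nt _ _)      = nt
  last-nontrivial (snoc _ _ nt _ _ _) = nt

  initLen : ∀ {x W y} → Walk1 x W y → Ord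
  initLen (one _ _ _ _)      = ozero
  initLen (snoc c _ _ _ _ _) = len1 c

  len1-initLen : ∀ {x W y} (c : Walk1 x W y) → len1 c ≡ initLen c ⊕ len0 W
  len1-initLen (one _ _ _ _)      = refl
  len1-initLen (snoc _ _ _ _ _ _) = refl

  RTerminal : Walk0 → X⁰ → Set
  RTerminal (fin n f _) a = f (fromℕ n) ≡ a
  RTerminal (ray _ _)   a = ⊥
  RTerminal (coray f _) a = f 0 ≡ a
  RTerminal (line _ _)  a = ⊥

  LTerminal : Walk0 → X⁰ → Set
  LTerminal (fin n f _) a = f fzero ≡ a
  LTerminal (ray f _)   a = f 0 ≡ a
  LTerminal (coray _ _) a = ⊥
  LTerminal (line _ _)  a = ⊥

  RReach-cases : ∀ V v → RReach V v →
                 (∃ λ i → v ≡ inj₂ i × RTip V i) ⊎ (∃ λ a → TermReach a v × RTerminal V a)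
  RReach-cases (fin n f _) v        t = inj₂ (_ , t , refl)
  RReach-cases (ray _ _)   (inj₂ i) t = inj₁ (i , refl , t)
  RReach-cases (coray f _) v        t = inj₂ (_ , t , refl)
  RReach-cases (line _ _)  (inj₂ i) t = inj₁ (i , refl , t)

  LReach-cases : ∀ W v → LReach W v →
                 (∃ λ i → v ≡ inj₂ i × LTip W i) ⊎ (∃ λ a → TermReach a v × LTerminal W a)
  LReach-cases (fin n f _) v        t = inj₂ (_ , t , refl)
  LReach-cases (ray f _)   v        t = inj₂ (_ , t , refl)
  LReach-cases (coray _ _) (inj₂ i) t = inj₁ (i , refl , t)
  LReach-cases (line _ _)  (inj₂ i) t = inj₁ (i , refl , t)

  concatThroughTip : ∀ {x V i W y} → Walk1 x V (inj₂ i) → (d : Walk1 (inj₂ i) W y) →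
                     RTip V i ⊎ LTip (first₀ d) i → Walk1 x W y
  concatThroughTip c (one W nt l r)       t = snoc c W nt l r t
  concatThroughTip c (snoc d W nt l r t′) t = snoc (concatThroughTip c d t) W nt l r t′

  len1-concatThroughTip : ∀ {x V i W y} (c : Walk1 x V (inj₂ i)) (d : Walk1 (inj₂ i) W y) t →
                          len1 (concatThroughTip c d t) ≡ len1 c ⊕ len1 d
  len1-concatThroughTip c (one _ _ _ _)      t = refl
  len1-concatThroughTip c (snoc d W _ _ _ _) t =
    trans (cong (_⊕ len0 W) (len1-concatThroughTip c d t)) (⊕-assoc (len1 c) (len1 d) (len0 W))

  first₀-concatThroughTip : ∀ {x V i W y} (c : Walk1 x V (inj₂ i)) (d : Walk1 (inj₂ i) W y) t →
                            first₀ (concatThroughTip c d t) ≡ first₀ c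
  first₀-concatThroughTip c (one _ _ _ _)      t = refl
  first₀-concatThroughTip c (snoc d _ _ _ _ _) t = first₀-concatThroughTip c d t

  reverse-one : ∀ {x y} W → Nontrivial W → LReach W x → RReach W y → Walk1 y (reverse₀ W) x
  reverse-one {x} {y} W nt l r =
    one (reverse₀ W) (reverse₀-nontrivial W nt) (reverse₀-LReach W y r) (reverse₀-RReach W x l)

  reverse₁ : ∀ {x W y} (c : Walk1 x W y) →
             Σ Walk0 λ W′ → Σ (Walk1 y W′ x) λ c′ → (len1 c′ ≡ len1 c) × (first₀ c′ ≡ reverse₀ W)
  reverse₁ (one W nt l r) = _ , reverse-one W nt l r , len0-reverse₀ W , refl
  reverse₁ (snoc {V} {i} c W nt l r t) with reverse₁ c
  ... | _ , c′ , len≡ , first≡ =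
    _ , concatThroughTip last c′ (junction t) , len≡′ , first₀-concatThroughTip last c′ (junction t)
    where
      last = reverse-one W nt l r
      junction : RTip V i ⊎ LTip W i → RTip (reverse₀ W) i ⊎ LTip (first₀ c′) i
      junction (inj₁ rt) = inj₂ (subst (λ U → LTip U i) (sym first≡) (reverse₀-LTip V i rt))
      junction (inj₂ lt) = inj₁ (reverse₀-RTip W i lt)
      len≡′ : len1 (concatThroughTip last c′ (junction t)) ≡ len1 c ⊕ len0 W
      len≡′ = trans (len1-concatThroughTip last c′ (junction t))
                (trans (cong₂ _⊕_ (len0-reverse₀ W) len≡) (⊕-comm (len0 W) (len1 c)))

  InheritsLeft : Walk0 → Walk0 → Set
  InheritsLeft M V = (∀ v → LReach V v → LReach M v) × (∀ i → LTip V i → LTip M i)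

  InheritsRight : Walk0 → Walk0 → Set
  InheritsRight M W = (∀ v → RReach W v → RReach M v) × (∀ i → RTip W i → RTip M i)

  record Merge (V W : Walk0) : Set where
    field
      walk       : Walk0
      nontrivial : Nontrivial walk
      left       : InheritsLeft walk V
      right      : InheritsRight walk W
      len-≤      : len0 walk ≤ₒ (len0 V ⊕ len0 W)

  -- the coray f followed by the ray g, glued at f 0 = g 0
  lineThrough : (ℕ → X⁰) → (ℕ → X⁰) → ℤ → X⁰
  lineThrough f g (+ n)    = g n
  lineThrough f g -[1+ n ] = f (suc n)

  lineThrough-adjacent : ∀ f g → (∀ n → Adj (f n) (f (suc n))) → (∀ n → Adj (g n) (g (suc n))) →
                         f 0 ≡ g 0 → ∀ i → Adj (lineThrough f g i) (lineThrough f g (i +ℤ + 1))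
  lineThrough-adjacent f g adjf adjg f0≡g0 (+ n)          = subst (Adj (g n) ∘ g) (ℕ.+-comm 1 n) (adjg n)
  lineThrough-adjacent f g adjf adjg f0≡g0 -[1+ zero ]    = subst (Adj (f 1)) f0≡g0 (Adj-sym (adjf 0))
  lineThrough-adjacent f g adjf adjg f0≡g0 -[1+ suc n ]   = Adj-sym (adjf (suc n))

  merge : ∀ V W {a} → RTerminal V a → LTerminal W a → Nontrivial V → Merge V W
  merge (fin n f adjf) (fin m g adjg) Vend Wstart ntV = record
    { walk       = finWalk (n + m) H
                     (splice-adjacent n m f′ g′ joint (clamp-adjacent f adjf) (clamp-adjacent g adjg))
    ; nontrivial = ℕ.≤-trans ntV (ℕ.m≤m+n n m)
    ; left       = (λ v → TermReach-subst v (sym (splice-start n f′ g′ joint))) , λ _ ()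
    ; right      = (λ v → TermReach-subst v (sym end)) , λ _ ()
    ; len-≤      = ≤ₒ-refl _ }
    where
      f′ = f ∘ clamp
      g′ = g ∘ clamp
      H = splice n f′ g′
      joint : f′ n ≡ g′ 0
      joint = trans (cong f (clamp-fromℕ n)) (trans Vend (sym Wstart))
      end : H (toℕ (fromℕ (n + m))) ≡ g (fromℕ m)
      end = trans (cong H (toℕ-fromℕ (n + m))) (trans (splice-shift n f′ g′ m) (cong g (clamp-fromℕ m)))
  merge (fin n f adjf) (ray g adjg) Vend Wstart _ = record
    { walk       = ray H (splice-adjacent-ray n f′ g joint (clamp-adjacent f adjf) adjg)
    ; nontrivial = tt
    ; left       = (λ v → TermReach-subst v (sym (splice-start n f′ g joint))) , λ _ ()
    ; right      = TipEnd-resp-EvEq {g} {H} (EvEq-splice n f′ g)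
    ; len-≤      = inj₂ (refl , z≤n) }
    where
      f′ = f ∘ clamp
      H = splice n f′ g
      joint : f′ n ≡ g 0
      joint = trans (cong f (clamp-fromℕ n)) (trans Vend (sym Wstart))
  merge (coray f adjf) (fin m g adjg) Vend Wstart _ = record
    { walk       = coray H (splice-adjacent-ray m g′ f joint
                              (AdjacentBelow-reverse m (g ∘ clamp) (clamp-adjacent g adjg)) adjf)
    ; nontrivial = tt
    ; left       = TipEnd-resp-EvEq {f} {H} (EvEq-splice m g′ f)
    ; right      = (λ v → TermReach-subst v (sym end)) , λ _ ()
    ; len-≤      = inj₂ (refl , z≤n) }
    where
      -- a coray is listed from its terminal 0-node outwards
      g′ = λ k → g (clamp (m ∸ k))
      H = splice m g′ f
      joint : g′ m ≡ f 0
      joint = trans (cong (g ∘ clamp) (ℕ.n∸n≡0 m)) (trans Wstart (sym Vend))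
      end : H 0 ≡ g (fromℕ m)
      end = trans (splice-start m g′ f joint) (cong g (clamp-fromℕ m))
  merge (coray f adjf) (ray g adjg) Vend Wstart _ = record
    { walk       = line H (lineThrough-adjacent f g adjf adjg (trans Vend (sym Wstart)))
    ; nontrivial = tt
    ; left       = TipEnd-resp-EvEq {f} {leftTail H} leftTail≈
    ; right      = TipEnd-resp-EvEq {g} {rightTail H} rightTail≈
    ; len-≤      = ≤ₒ-refl _ }
    where
      H = lineThrough f g
      leftTail≈ : EvEq f (leftTail H)
      leftTail≈ = 1 , 1 , λ _ → refl
      rightTail≈ : EvEq g (rightTail H)
      rightTail≈ = 0 , 0 , λ _ → refl
  merge (fin _ _ _) (coray _ _) _ () _
  merge (fin _ _ _) (line _ _)  _ () _
  merge (coray _ _) (coray _ _) _ () _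
  merge (coray _ _) (line _ _)  _ () _
  merge (ray _ _)   _           () _ _
  merge (line _ _)  _           () _ _

  replaceLast : ∀ {x V y y′} → Walk1 x V y → (M : Walk0) → Nontrivial M → InheritsLeft M V →
                RReach M y′ → Walk1 x M y′
  replaceLast (one _ _ l _)      M nt (lr , _)  r = one M nt (lr _ l) r
  replaceLast (snoc c _ _ l _ t) M nt (lr , lt) r = snoc c M nt (lr _ l) r (map₂ (lt _) t)

  len1-replaceLast : ∀ {x V y y′} (c : Walk1 x V y) M nt inherits (r : RReach M y′) →
                     len1 (replaceLast c M nt inherits r) ≡ initLen c ⊕ len0 M
  len1-replaceLast (one _ _ _ _)      M nt inherits r = refl
  len1-replaceLast (snoc _ _ _ _ _ _) M nt inherits r = refl

  concatAtTerminal : ∀ {x y z V W a} (c : Walk1 x V y) → RTerminal V a →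
                     (d : Walk1 y W z) → LTerminal (first₀ d) a →
                     Σ Walk0 λ M → Σ (Walk1 x M z) λ e →
                       (∀ i → RTip W i → RTip M i) × (len1 e ≤ₒ (len1 c ⊕ len1 d))
  concatAtTerminal {V = V} c Vend (one W _ _ r) Wstart =
    walk , replaceLast c walk nontrivial left (proj₁ right _ r) , proj₂ right , len≤
    where
      open Merge (merge V W Vend Wstart (last-nontrivial c))
      regroup : initLen c ⊕ (len0 V ⊕ len0 W) ≡ len1 c ⊕ len0 W
      regroup = trans (sym (⊕-assoc (initLen c) (len0 V) (len0 W))) (cong (_⊕ len0 W) (sym (len1-initLen c)))
      len≤ : len1 (replaceLast c walk nontrivial left (proj₁ right _ r)) ≤ₒ (len1 c ⊕ len0 W)
      len≤ = subst₂ _≤ₒ_ (sym (len1-replaceLast c walk nontrivial left _)) regroup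
               (⊕-monoʳ-≤ₒ (initLen c) len-≤)
  concatAtTerminal c Vend (snoc d W nt l r t) Wstart with concatAtTerminal c Vend d Wstart
  ... | _ , e , inherits , len≤ =
    W , snoc e W nt l r (map₁ (inherits _) t) , (λ _ rt → rt) ,
    subst ((len1 e ⊕ len0 W) ≤ₒ_) (⊕-assoc (len1 c) (len1 d) (len0 W)) (⊕-monoˡ-≤ₒ (len0 W) len≤)

  concat : ∀ {x y z V W} (c : Walk1 x V y) (d : Walk1 y W z) →
           Σ Walk0 λ U → Σ (Walk1 x U z) λ e → len1 e ≤ₒ (len1 c ⊕ len1 d)
  concat {V = V} c d with RReach-cases V _ (last-RReach c) | LReach-cases (first₀ d) _ (first₀-LReach d)
  ... | inj₁ (_ , refl , rt) | _ =
    _ , concatThroughTip c d (inj₁ rt) , ≤ₒ-reflexive (len1-concatThroughTip c d _)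
  ... | inj₂ _ | inj₁ (_ , refl , lt) =
    _ , concatThroughTip c d (inj₂ lt) , ≤ₒ-reflexive (len1-concatThroughTip c d _)
  ... | inj₂ (a , ra , Vend) | inj₂ (b , rb , Wstart)
    with concatAtTerminal c Vend d (subst (LTerminal (first₀ d)) (TermReach-unique _ rb ra) Wstart)
  ... | M , e , _ , len≤ = M , e , len≤

  toWalk1 : ∀ {x y} → x ≢ y → (w : TwoEnded x y) →
            Σ Walk0 λ U → Σ (Walk1 x U y) λ c → len1 c ≡ len w
  toWalk1 x≢y (walk0 zero    _ _   refl refl) = ⊥-elim (x≢y refl)
  toWalk1 _   (walk0 (suc n) f adj refl refl) = _ , one (fin (suc n) f adj) (s≤s z≤n) refl refl , refl
  toWalk1 _   (walk1 W c)                     = W , c , refl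

  len0-positive : ∀ W → Nontrivial W → ozero <ₒ len0 W
  len0-positive (fin _ _ _) 1≤n = inj₂ (refl , 1≤n)
  len0-positive (ray _ _)   _   = inj₁ (s≤s z≤n)
  len0-positive (coray _ _) _   = inj₁ (s≤s z≤n)
  len0-positive (line _ _)  _   = inj₁ (s≤s z≤n)

  len1-positive : ∀ {x W y} (c : Walk1 x W y) → ozero <ₒ len1 c
  len1-positive (one W nt _ _)      = len0-positive W nt
  len1-positive (snoc c W nt _ _ _) = ⊕-positiveʳ (len1 c) (len0-positive W nt)

  len-positive : ∀ {x y} → x ≢ y → (w : TwoEnded x y) → ozero <ₒ len w
  len-positive x≢y w with toWalk1 x≢y w
  ... | _ , c , len≡ = subst (ozero <ₒ_) len≡ (len1-positive c)

  TwoEnded-reverse : ∀ {x y} → x ≢ y → (w : TwoEnded x y) → Σ (TwoEnded y x) λ w′ → len w′ ≡ len w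
  TwoEnded-reverse x≢y w with toWalk1 x≢y w
  ... | _ , c , len≡ with reverse₁ c
  ... | _ , c′ , len≡′ , _ = walk1 _ c′ , trans len≡′ len≡

  TwoEnded-concat : ∀ {x y z} → x ≢ y → y ≢ z → (w : TwoEnded x y) (w′ : TwoEnded y z) →
                    Σ (TwoEnded x z) λ w″ → len w″ ≤ₒ (len w ⊕ len w′)
  TwoEnded-concat x≢y y≢z w w′ with toWalk1 x≢y w | toWalk1 y≢z w′
  ... | _ , c , len≡ | _ , c′ , len≡′ with concat c c′
  ... | _ , e , len≤ = walk1 _ e , subst (len1 e ≤ₒ_) (cong₂ _⊕_ len≡ len≡′) len≤

  IsWDist-diag : ∀ {x o} → IsWDist x x o → o ≡ ozero
  IsWDist-diag (inj₁ (_ , o≡0)) = o≡0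
  IsWDist-diag (inj₂ (x≢x , _)) = ⊥-elim (x≢x refl)

  IsWDist-minimal : ∀ {x y o} → IsWDist x y o → (w : TwoEnded x y) → o ≤ₒ len w
  IsWDist-minimal (inj₁ (_ , refl))    w = ozero-≤ₒ (len w)
  IsWDist-minimal (inj₂ (_ , _ , min)) w = min w

  IsWDist-positive : ∀ {x y o} → x ≢ y → IsWDist x y o → ozero <ₒ o
  IsWDist-positive x≢y (inj₁ (x≡y , _))            = ⊥-elim (x≢y x≡y)
  IsWDist-positive x≢y (inj₂ (_ , (w , refl) , _)) = len-positive x≢y w

  IsWDist-≤ : ∀ {x y o o′} → IsWDist x y o → IsWDist x y o′ → o ≤ₒ o′
  IsWDist-≤ h (inj₁ (refl , refl))        = ≤ₒ-reflexive (IsWDist-diag h)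
  IsWDist-≤ h (inj₂ (_ , (w , refl) , _)) = IsWDist-minimal h w

  IsWDist-≤-reverse : ∀ {x y o o′} → IsWDist x y o → IsWDist y x o′ → o′ ≤ₒ o
  IsWDist-≤-reverse (inj₁ (refl , refl))          h′ = ≤ₒ-reflexive (IsWDist-diag h′)
  IsWDist-≤-reverse (inj₂ (x≢y , (w , refl) , _)) h′ with TwoEnded-reverse x≢y w
  ... | w′ , len≡ = subst (_ ≤ₒ_) len≡ (IsWDist-minimal h′ w′)

  IsWDist-sym : ∀ {x y o o′} → IsWDist x y o → IsWDist y x o′ → o ≡ o′
  IsWDist-sym h h′ = ≤ₒ-antisym (IsWDist-≤-reverse h′ h) (IsWDist-≤-reverse h h′)

  IsWDist-triangle : ∀ {x y z o o₁ o₂} → IsWDist x z o → IsWDist x y o₁ → IsWDist y z o₂ →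
                     o ≤ₒ (o₁ ⊕ o₂)
  IsWDist-triangle hxz (inj₁ (refl , refl)) hyz = IsWDist-≤ hxz hyz
  IsWDist-triangle {o = o} {o₁ = o₁} hxz hxy (inj₁ (refl , refl)) =
    subst (o ≤ₒ_) (sym (⊕-identityʳ o₁)) (IsWDist-≤ hxz hxy)
  IsWDist-triangle hxz (inj₂ (x≢y , (w , refl) , _)) (inj₂ (y≢z , (w′ , refl) , _))
    with TwoEnded-concat x≢y y≢z w w′
  ... | w″ , len≤ = ≤ₒ-trans (IsWDist-minimal hxz w″) len≤

lemma7p1 : (G : OneGraph) →
    let open OneGraphTheory G in
    (∀ (x y : Node) → x ≢ y → TwoEnded x y) →
    (d : Node → Node → Ord) → (∀ x y → IsWDist x y (d x y)) →
    ∀ (x y z : Node) → Maximal x → Maximal y → Maximal z →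
    (d x x ≡ ozero) × (x ≢ y → ozero <ₒ d x y) × (d x y ≡ d y x)
      × (d x z ≤ₒ (d x y ⊕ d y z))
lemma7p1 G _ d isWDist x y z _ _ _ =
  IsWDist-diag (isWDist x x) ,
  (λ x≢y → IsWDist-positive x≢y (isWDist x y)) ,
  IsWDist-sym (isWDist x y) (isWDist y x) ,
  IsWDist-triangle (isWDist x z) (isWDist x y) (isWDist y z)
  where open Walks G
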